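{- Let $k\ge2$ divide $q-1$ and let $a_0,a_1\in\mathbb{F}_q$. The cyclotomic map $\theta$ of index $k$ with multipliers $[a_0,a_1,a_1,\dots,a_1]$ is a near-linear orthomorphism if and only if $a_0\neq a_1$, $\eta_k(a_0)=\eta_k(a_1)$ and $\eta_k(a_0-1)=\eta_k(a_1-1)$.
   Context: Let $\mathbb{F}_q$ be the finite field of order $q$. An orthomorphism over $\mathbb{F}_q$ is a permutation $\theta$ of $\mathbb{F}_q$ such that $x\mapsto\theta(x)-x$ is also a permutation. For $k\mid(q-1)$, $\eta_k$ denotes a multiplicative character of $\mathbb{F}_q$ of order $k$ (extended by $\eta_k(0)=0$), $\omega_k$ a primitive complex $k$-th root of unity, and the cyclotomy classes of index $k$ are $C_{k,i}=\eta_k^{ -1}(\omega_k^i)$, $0\le i<k$ (the cosets of the subgroup of index $k$ in $\mathbb{F}_q^*$). A cyclotomic map of index $k$ with multipliers $[a_0,\dots,a_{k-1}]$ is $\theta(0)=0$, $\theta(x)=a_ix$ for $x\in C_{k,i}$. A near-linear orthomorphism of index $k$ is an orthomorphism that is a cyclotomic map of index $k$ whose multipliers satisfy $a_0\neq a_1=\cdots=a_{k-1}$. -}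

module Defs where

open import Level using (0ℓ)
open import Data.Nat using (ℕ; zero; suc; _∸_; _%_; _≥_; NonZero)
open import Data.Nat.Divisibility using (_∣_)
open import Data.Fin using (Fin; toℕ)
import Data.Fin
open import Data.Nat.DivMod using (_mod_)
open import Data.List using (List; upTo)
open import Data.Maybe using (Maybe; just; nothing)
open import Data.Product using (∃; _×_)
open import Relation.Nullary using (¬_; yes; no)
open import Relation.Binary.PropositionalEquality using (_≡_; _≢_)
open import Relation.Binary.Definitions using (DecidableEquality)
open import Algebra.Structures using (IsCommutativeRing)
open import Function.Bundles using (_↔_)
open import Function.Definitions using (Bijective)

record FiniteField : Set₁ where
  infixl 7 _*_
  infixl 6 _+_ _-_
  field
    Carrier : Set
    _+_ _*_ : Carrier → Carrier → Carrier
    -_ : Carrier → Carrier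
    0# 1# : Carrier
    isCommutativeRing : IsCommutativeRing _≡_ _+_ _*_ -_ 0# 1#
    0≢1 : 0# ≢ 1#
    inverse : ∀ x → x ≢ 0# → ∃ λ y → x * y ≡ 1#
    _≟_ : DecidableEquality Carrier
    q : ℕ
    enumeration : Fin q ↔ Carrier

  _-_ : Carrier → Carrier → Carrier
  x - y = x + (- y)

  _^_ : Carrier → ℕ → Carrier
  x ^ zero = 1#
  x ^ suc n = x * (x ^ n)

module _ (F : FiniteField) where
  open FiniteField F

  Primitive : Carrier → Set
  Primitive g = g ≢ 0# × (∀ x → x ≢ 0# → ∃ λ j → g ^ j ≡ x)

  -- discrete logarithm to base g: the least j < q - 1 with g^j = x, if any
  -- (for x ≠ 0 and g primitive it always exists; for x = 0 it never does).
  dlogFrom : Carrier → Carrier → List ℕ → Maybe ℕ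
  dlogFrom g x Data.List.[] = nothing
  dlogFrom g x (j Data.List.∷ js) with (g ^ j) ≟ x
  ... | yes _ = just j
  ... | no _ = dlogFrom g x js

  dlog : Carrier → Carrier → Maybe ℕ
  dlog g x = dlogFrom g x (upTo (q ∸ 1))

  -- The multiplicative character η_k of order k with η_k(g) = ω_k, extended by
  -- η_k(0) = 0.  Its value ω_k^i is represented by  just i  (i : Fin k),
  -- and the value 0 by  nothing.
  eta : (k : ℕ) .{{_ : NonZero k}} → Carrier → Carrier → Maybe (Fin k)
  eta k g x with dlog g x
  ... | nothing = nothing
  ... | just j = just (j mod k)

  cyclotomicMap : (k : ℕ) .{{_ : NonZero k}} → Carrier → (Fin k → Carrier) → Carrier → Carrier
  cyclotomicMap k g a x with eta k g x
  ... | nothing = 0#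
  ... | just i = a i * x

  nearLinearMultipliers : (k : ℕ) → Carrier → Carrier → Fin k → Carrier
  nearLinearMultipliers k a₀ a₁ Data.Fin.zero = a₀
  nearLinearMultipliers k a₀ a₁ (Data.Fin.suc _) = a₁

  IsOrthomorphism : (Carrier → Carrier) → Set
  IsOrthomorphism θ = Bijective _≡_ _≡_ θ × Bijective _≡_ _≡_ (λ x → θ x - x)

  IsNearLinearOrthomorphism : (k : ℕ) .{{_ : NonZero k}} → Carrier → (Fin k → Carrier) → Set
  IsNearLinearOrthomorphism k g a =
    IsOrthomorphism (cyclotomicMap k g a)
    × (∀ i j → toℕ i ≡ 0 → toℕ j ≢ 0 → a i ≢ a j)
    × (∀ i j → toℕ i ≢ 0 → toℕ j ≢ 0 → a i ≡ a j)

{-# OPTIONS --safe #-}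
-- θ(x) − x is again cyclotomic, with multipliers [a₀ − 1, a₁ − 1, …, a₁ − 1], and an injective
-- self-map of a finite set is bijective; so it suffices that, for b₀ ≠ b₁, the map with multipliers
-- [b₀, b₁, …, b₁] is injective iff η(b₀) = η(b₁). If both lie in C_e, the map sends each class C_i
-- injectively into C_{i+e}, so it is injective. Conversely, injectivity forces b₀, b₁ ≠ 0, and if
-- b₀ = b₁ y with y ∉ C_0 then θ(y) = b₀ = θ(1). Index computations rest on g having order exactly
-- q − 1, which follows by pigeonhole (some g^c = 1 with 0 < c ≤ q − 1) and counting (g^c = 1 with
-- c > 0 makes every element 0 or one of g^0, …, g^(c−1), so q ≤ c + 1).
module Submission where

open import Defs
open import Level using (0ℓ)
open import Data.Nat as ℕ
  using (ℕ; zero; suc; _+_; _∸_; _≤_; _<_; _≥_; s≤s; s≤s⁻¹; NonZero; >-nonZero; ≢-nonZero; _%_; _/_)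
open import Data.Nat.Properties
  using (1+n≰n; n<1+n; ≤-trans; ≤-total; ≤-antisym; <⇒≤; <-≤-trans; <⇒≱; m∸n≤m; ∸-monoˡ-≤; m<n⇒0<n∸m; m+[n∸m]≡n)
  renaming (_≟_ to _≟ℕ_)
open import Data.Nat.DivMod
  using (_mod_; m≡m%n+[m/n]*n; m%n<n; m<n⇒m%n≡m; %-remove-+ʳ; %-distribˡ-+)
open import Data.Nat.Divisibility using (_∣_; ∣-trans; m%n≡0⇒n∣m)
open import Data.Fin using (Fin; zero; suc; toℕ; fromℕ<; punchOut)
open import Data.Fin.Properties
  using (any?; injective⇒≤; pigeonhole; punchOut-injective; fromℕ<-cong; fromℕ<-injective; fromℕ<-toℕ; toℕ<n; toℕ-fromℕ<)
  renaming (_≟_ to _≟ᶠ_)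
open import Data.List using ([]; _∷_; upTo)
open import Data.List.Membership.Propositional using (_∈_)
open import Data.List.Membership.Propositional.Properties using (∈-upTo⁺)
open import Data.List.Relation.Unary.Any using (here; there)
open import Data.Maybe using (Maybe; just; nothing)
open import Data.Maybe.Properties using (just-injective)
open import Data.Product using (∃; _×_; _,_; proj₁; proj₂)
open import Data.Sum using (inj₁; inj₂)
open import Relation.Nullary using (yes; no; contradiction)
open import Relation.Binary.PropositionalEquality
open import Function using (_∘_; _↔_; Inverse; Injection; _⇔_; mk⇔; Equivalence)
open import Function.Properties.Inverse using (↔⇒↣; ↔-sym)
open import Function.Definitions using (Injective; Bijective; StrictlySurjective)
open import Function.Consequences.Propositional using (strictlySurjective⇒surjective)
open import Algebra.Bundles using (CommutativeRing)
open import Algebra.Structures using (IsCommutativeRing)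
import Algebra.Properties.Ring as RingProperties

injective⇒strictlySurjective : ∀ {n} {f : Fin n → Fin n}
  → Injective _≡_ _≡_ f → StrictlySurjective _≡_ f
injective⇒strictlySurjective {suc n} {f} f-inj y with any? (λ x → f x ≟ᶠ y)
... | yes hit = hit
... | no miss = contradiction (injective⇒≤ punchOut∘f-injective) 1+n≰n
  where
    y≢f : ∀ x → y ≢ f x
    y≢f x y≡fx = miss (x , sym y≡fx)

    punchOut∘f-injective : Injective _≡_ _≡_ (λ x → punchOut (y≢f x))
    punchOut∘f-injective e = f-inj (punchOut-injective (y≢f _) (y≢f _) e)

injective-≗ : ∀ {A B : Set} {f h : A → B}
  → (∀ x → f x ≡ h x) → Injective _≡_ _≡_ f → Injective _≡_ _≡_ h
injective-≗ f≗h f-inj {x} {y} e = f-inj (trans (f≗h x) (trans e (sym (f≗h y))))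

module _ {A : Set} {n : ℕ} (enumeration : Fin n ↔ A) where
  open Inverse enumeration

  to-injective : Injective _≡_ _≡_ to
  to-injective = Injection.injective (↔⇒↣ enumeration)

  from-injective : Injective _≡_ _≡_ from
  from-injective = Injection.injective (↔⇒↣ (↔-sym enumeration))

  injective⇒bijective : {f : A → A} → Injective _≡_ _≡_ f → Bijective _≡_ _≡_ f
  injective⇒bijective {f} f-inj = f-inj , strictlySurjective⇒surjective f-strictlySurjective
    where
      f-strictlySurjective : StrictlySurjective _≡_ f
      f-strictlySurjective y
        with i , e ← injective⇒strictlySurjective (to-injective ∘ f-inj ∘ from-injective) (from y)
        = to i , from-injective e

module FieldProperties (F : FiniteField) where
  open FiniteField F hiding (_+_)
  open IsCommutativeRing isCommutativeRing
    using (*-assoc; *-comm; *-identityˡ; *-identityʳ; zeroˡ; zeroʳ; distribʳ)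

  commutativeRing : CommutativeRing 0ℓ 0ℓ
  commutativeRing = record { isCommutativeRing = isCommutativeRing }

  open RingProperties (CommutativeRing.ring commutativeRing) using (-1*x≈-x; +-cancelʳ)
  open ≡-Reasoning

  inverse-≢0 : ∀ {x y} → x * y ≡ 1# → y ≢ 0#
  inverse-≢0 {x} xy≡1 y≡0 = 0≢1 (trans (sym (zeroʳ x)) (trans (cong (x *_) (sym y≡0)) xy≡1))

  inverse-cancelˡ : ∀ {x y} z → y * x ≡ 1# → y * (x * z) ≡ z
  inverse-cancelˡ {x} {y} z yx≡1 = trans (sym (*-assoc y x z)) (trans (cong (_* z) yx≡1) (*-identityˡ z))

  *-cancelˡ : ∀ {x y z} → x ≢ 0# → x * y ≡ x * z → y ≡ z
  *-cancelˡ {x} {y} {z} x≢0 xy≡xz with x′ , xx′≡1 ← inverse x x≢0 = begin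
    y             ≡⟨ sym (inverse-cancelˡ y x′x≡1) ⟩
    x′ * (x * y)  ≡⟨ cong (x′ *_) xy≡xz ⟩
    x′ * (x * z)  ≡⟨ inverse-cancelˡ z x′x≡1 ⟩
    z             ∎
    where
      x′x≡1 : x′ * x ≡ 1#
      x′x≡1 = trans (*-comm x′ x) xx′≡1

  *-≢0 : ∀ {x y} → x ≢ 0# → y ≢ 0# → x * y ≢ 0#
  *-≢0 {x} x≢0 y≢0 xy≡0 = y≢0 (*-cancelˡ x≢0 (trans xy≡0 (sym (zeroʳ x))))

  ^-+ : ∀ x m n → x ^ (m + n) ≡ x ^ m * x ^ n
  ^-+ x zero    n = sym (*-identityˡ _)
  ^-+ x (suc m) n = trans (cong (x *_) (^-+ x m n)) (sym (*-assoc x _ _))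

  ^-≢0 : ∀ {x} n → x ≢ 0# → x ^ n ≢ 0#
  ^-≢0 zero    _   1≡0 = 0≢1 (sym 1≡0)
  ^-≢0 (suc n) x≢0 = *-≢0 x≢0 (^-≢0 n x≢0)

  ^-*-≡1 : ∀ {x c} m → x ^ c ≡ 1# → x ^ (m ℕ.* c) ≡ 1#
  ^-*-≡1 zero    _ = refl
  ^-*-≡1 {x} {c} (suc m) xᶜ≡1 = begin
    x ^ (c + m ℕ.* c)     ≡⟨ ^-+ x c (m ℕ.* c) ⟩
    x ^ c * x ^ (m ℕ.* c) ≡⟨ cong₂ _*_ xᶜ≡1 (^-*-≡1 m xᶜ≡1) ⟩
    1# * 1#               ≡⟨ *-identityˡ 1# ⟩
    1#                    ∎

  ^-% : ∀ {x} c .{{_ : NonZero c}} t → x ^ c ≡ 1# → x ^ t ≡ x ^ (t % c)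
  ^-% {x} c t xᶜ≡1 = begin
    x ^ t                              ≡⟨ cong (x ^_) (m≡m%n+[m/n]*n t c) ⟩
    x ^ (t % c + (t / c) ℕ.* c)        ≡⟨ ^-+ x (t % c) _ ⟩
    x ^ (t % c) * x ^ ((t / c) ℕ.* c)  ≡⟨ cong (x ^ (t % c) *_) (^-*-≡1 (t / c) xᶜ≡1) ⟩
    x ^ (t % c) * 1#                   ≡⟨ *-identityʳ _ ⟩
    x ^ (t % c)                        ∎

  ^-≡⇒^-∸≡1 : ∀ {x a b} → x ≢ 0# → a ≤ b → x ^ a ≡ x ^ b → x ^ (b ∸ a) ≡ 1#
  ^-≡⇒^-∸≡1 {x} {a} {b} x≢0 a≤b xᵃ≡xᵇ = *-cancelˡ (^-≢0 a x≢0) (begin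
    x ^ a * x ^ (b ∸ a)  ≡⟨ sym (^-+ x a (b ∸ a)) ⟩
    x ^ (a + (b ∸ a))    ≡⟨ cong (x ^_) (m+[n∸m]≡n a≤b) ⟩
    x ^ b                ≡⟨ sym xᵃ≡xᵇ ⟩
    x ^ a                ≡⟨ sym (*-identityʳ _) ⟩
    x ^ a * 1#           ∎)

  a*x-x≡[a-1]*x : ∀ a x → a * x - x ≡ (a - 1#) * x
  a*x-x≡[a-1]*x a x = sym (trans (distribʳ x a (- 1#)) (cong (FiniteField._+_ F (a * x)) (-1*x≈-x x)))

  a-1≡b-1⇒a≡b : ∀ {a b} → a - 1# ≡ b - 1# → a ≡ b
  a-1≡b-1⇒a≡b {a} {b} = +-cancelʳ (- 1#) a b

  dlogFrom-0 : ∀ {g} → g ≢ 0# → ∀ js → dlogFrom F g 0# js ≡ nothing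
  dlogFrom-0 g≢0 []       = refl
  dlogFrom-0 {g} g≢0 (j ∷ js) with (g ^ j) ≟ 0#
  ... | yes gʲ≡0 = contradiction gʲ≡0 (^-≢0 j g≢0)
  ... | no _     = dlogFrom-0 g≢0 js

  dlogFrom-complete : ∀ g x {j} js → j ∈ js → g ^ j ≡ x
    → ∃ λ j′ → dlogFrom F g x js ≡ just j′ × g ^ j′ ≡ x
  dlogFrom-complete g x (j′ ∷ js) j∈ gʲ≡x with (g ^ j′) ≟ x
  dlogFrom-complete g x (j′ ∷ js) j∈          gʲ≡x | yes gʲ′≡x = j′ , refl , gʲ′≡x
  dlogFrom-complete g x (j′ ∷ js) (here refl) gʲ≡x | no gʲ′≢x  = contradiction gʲ≡x gʲ′≢x
  dlogFrom-complete g x (j′ ∷ js) (there j∈)  gʲ≡x | no _      = dlogFrom-complete g x js j∈ gʲ≡x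

  isOrthomorphism⇔ : (θ : Carrier → Carrier)
    → IsOrthomorphism F θ ⇔ (Injective _≡_ _≡_ θ × Injective _≡_ _≡_ (λ x → θ x - x))
  isOrthomorphism⇔ θ = mk⇔
    (λ (θ-bij , θ-id-bij) → proj₁ θ-bij , proj₁ θ-id-bij)
    (λ (θ-inj , θ-id-inj) → injective⇒bijective enumeration θ-inj , injective⇒bijective enumeration θ-id-inj)

  nearLinearMultipliers-distinct : ∀ {k a₀ a₁} → a₀ ≢ a₁
    → ∀ i j → toℕ i ≡ 0 → toℕ j ≢ 0
    → nearLinearMultipliers F k a₀ a₁ i ≢ nearLinearMultipliers F k a₀ a₁ j
  nearLinearMultipliers-distinct a₀≢a₁ zero zero    _ j≢0 = contradiction refl j≢0
  nearLinearMultipliers-distinct a₀≢a₁ zero (suc j) _ _   = a₀≢a₁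

  nearLinearMultipliers-constant : ∀ {k a₀ a₁}
    → ∀ i j → toℕ i ≢ 0 → toℕ j ≢ 0
    → nearLinearMultipliers F k a₀ a₁ i ≡ nearLinearMultipliers F k a₀ a₁ j
  nearLinearMultipliers-constant zero    _       i≢0 _   = contradiction refl i≢0
  nearLinearMultipliers-constant (suc i) zero    _   j≢0 = contradiction refl j≢0
  nearLinearMultipliers-constant (suc i) (suc j) _   _   = refl

module PrimitiveElement (F : FiniteField) (g : FiniteField.Carrier F) (prim : Primitive F g) where
  open FiniteField F hiding (_+_)
  open IsCommutativeRing isCommutativeRing using (*-comm; *-identityʳ; zeroˡ; zeroʳ; -‿inverseʳ)
  open FieldProperties F

  g≢0 : g ≢ 0#
  g≢0 = proj₁ prim

  log : ∀ x → x ≢ 0# → ∃ λ t → g ^ t ≡ x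
  log = proj₂ prim

  N : ℕ
  N = q ∸ 1

  zeroOrPower : ∀ {m} → Fin (suc m) → Carrier
  zeroOrPower zero    = 0#
  zeroOrPower (suc i) = g ^ toℕ i

  open Inverse enumeration using (to; from)
  open ≡-Reasoning

  ^-≡1⇒N≤ : ∀ c .{{_ : NonZero c}} → g ^ c ≡ 1# → N ≤ c
  ^-≡1⇒N≤ c gᶜ≡1 = ∸-monoˡ-≤ 1 (injective⇒≤ (to-injective enumeration ∘ index-injective))
    where
      index : Carrier → Fin (suc c)
      index x with x ≟ 0#
      ... | yes _   = zero
      ... | no x≢0 = suc (fromℕ< (m%n<n (proj₁ (log x x≢0)) c))

      zeroOrPower∘index : ∀ x → zeroOrPower (index x) ≡ x
      zeroOrPower∘index x with x ≟ 0#
      ... | yes x≡0 = sym x≡0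
      ... | no x≢0 with t , gᵗ≡x ← log x x≢0 = begin
        g ^ toℕ (fromℕ< (m%n<n t c))  ≡⟨ cong (g ^_) (toℕ-fromℕ< (m%n<n t c)) ⟩
        g ^ (t % c)                   ≡⟨ sym (^-% c t gᶜ≡1) ⟩
        g ^ t                         ≡⟨ gᵗ≡x ⟩
        x                             ∎

      index-injective : Injective _≡_ _≡_ index
      index-injective {x} {y} e = begin
        x                      ≡⟨ sym (zeroOrPower∘index x) ⟩
        zeroOrPower (index x)  ≡⟨ cong zeroOrPower e ⟩
        zeroOrPower (index y)  ≡⟨ zeroOrPower∘index y ⟩
        y                      ∎

  period : ∃ λ c → 0 < c × c ≤ N × g ^ c ≡ 1#
  period with pigeonhole (n<1+n q) (from ∘ zeroOrPower {q})
  ... | zero  , zero  , () , _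
  ... | zero  , suc j , _  , e = contradiction (sym (from-injective enumeration e)) (^-≢0 (toℕ j) g≢0)
  ... | suc i , suc j , i<j , e =
    toℕ j ∸ toℕ i , m<n⇒0<n∸m (s≤s⁻¹ i<j) ,
    ≤-trans (m∸n≤m (toℕ j) (toℕ i)) (∸-monoˡ-≤ 1 (toℕ<n j)) ,
    ^-≡⇒^-∸≡1 g≢0 (<⇒≤ (s≤s⁻¹ i<j)) (from-injective enumeration e)

  0<N : 0 < N
  0<N with c , 0<c , c≤N , _ ← period = <-≤-trans 0<c c≤N

  instance
    N-nonZero : NonZero N
    N-nonZero = >-nonZero 0<N

  ^N≡1 : g ^ N ≡ 1#
  ^N≡1 with c , 0<c , c≤N , gᶜ≡1 ← period =
    subst (λ n → g ^ n ≡ 1#) (≤-antisym c≤N (^-≡1⇒N≤ c {{>-nonZero 0<c}} gᶜ≡1)) gᶜ≡1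

  ^-≡1⇒N∣ : ∀ c → g ^ c ≡ 1# → N ∣ c
  ^-≡1⇒N∣ c gᶜ≡1 with c % N ≟ℕ 0
  ... | yes c%N≡0 = m%n≡0⇒n∣m c N c%N≡0
  ... | no c%N≢0 = contradiction
        (^-≡1⇒N≤ (c % N) {{≢-nonZero c%N≢0}} (trans (sym (^-% N c ^N≡1)) gᶜ≡1))
        (<⇒≱ (m%n<n c N))

  module Classes (k : ℕ) .{{_ : NonZero k}} (k∣N : k ∣ N) where
    η : Carrier → Maybe (Fin k)
    η = eta F k g

    ≤-∧-^-≡⇒%-≡ : ∀ {a b} → a ≤ b → g ^ a ≡ g ^ b → a % k ≡ b % k
    ≤-∧-^-≡⇒%-≡ {a} {b} a≤b gᵃ≡gᵇ = begin
      a % k              ≡⟨ sym (%-remove-+ʳ a (∣-trans k∣N (^-≡1⇒N∣ (b ∸ a) gᵇ⁻ᵃ≡1))) ⟩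
      (a + (b ∸ a)) % k  ≡⟨ cong (_% k) (m+[n∸m]≡n a≤b) ⟩
      b % k              ∎
      where
        gᵇ⁻ᵃ≡1 : g ^ (b ∸ a) ≡ 1#
        gᵇ⁻ᵃ≡1 = ^-≡⇒^-∸≡1 g≢0 a≤b gᵃ≡gᵇ

    ^-≡⇒%-≡ : ∀ a b → g ^ a ≡ g ^ b → a % k ≡ b % k
    ^-≡⇒%-≡ a b gᵃ≡gᵇ with ≤-total a b
    ... | inj₁ a≤b = ≤-∧-^-≡⇒%-≡ a≤b gᵃ≡gᵇ
    ... | inj₂ b≤a = sym (≤-∧-^-≡⇒%-≡ b≤a (sym gᵃ≡gᵇ))

    η-dlog : ∀ {x j} → dlog F g x ≡ just j → η x ≡ just (j mod k)
    η-dlog dlog≡j rewrite dlog≡j = refl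

    η-0 : η 0# ≡ nothing
    η-0 rewrite dlogFrom-0 g≢0 (upTo N) = refl

    η-^ : ∀ t → η (g ^ t) ≡ just (t mod k)
    η-^ t
      with j , dlog≡j , gʲ≡gᵗ ← dlogFrom-complete g (g ^ t) (upTo N)
                                  (∈-upTo⁺ (m%n<n t N)) (sym (^-% N t ^N≡1))
      = trans (η-dlog dlog≡j) (cong just (fromℕ<-cong _ _ (^-≡⇒%-≡ j t gʲ≡gᵗ) _ _))

    η-≢0 : ∀ {x} → x ≢ 0# → ∃ λ i → η x ≡ just i
    η-≢0 {x} x≢0 with t , refl ← log x x≢0 = t mod k , η-^ t

    toℕ-mod : ∀ i → toℕ i mod k ≡ i
    toℕ-mod i = trans (fromℕ<-cong _ _ (m<n⇒m%n≡m (toℕ<n i)) _ _) (fromℕ<-toℕ i (toℕ<n i))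

    η-^-≡⇒%-≡ : ∀ a b → η (g ^ a) ≡ η (g ^ b) → a % k ≡ b % k
    η-^-≡⇒%-≡ a b ηgᵃ≡ηgᵇ =
      fromℕ<-injective _ _ _ _ (just-injective (trans (sym (η-^ a)) (trans ηgᵃ≡ηgᵇ (η-^ b))))

    %-≡⇒η-^-≡ : ∀ a b → a % k ≡ b % k → η (g ^ a) ≡ η (g ^ b)
    %-≡⇒η-^-≡ a b a%k≡b%k =
      trans (η-^ a) (trans (cong just (fromℕ<-cong _ _ a%k≡b%k _ _)) (sym (η-^ b)))

    η-≡nothing⇒≡0 : ∀ {x} → η x ≡ nothing → x ≡ 0#
    η-≡nothing⇒≡0 {x} ηx≡nothing with x ≟ 0#
    ... | yes x≡0 = x≡0
    ... | no x≢0 with t , refl ← log x x≢0 with () ← trans (sym (η-^ t)) ηx≡nothing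

    η-≡∧≡0⇒≡0 : ∀ {x y} → η x ≡ η y → x ≡ 0# → y ≡ 0#
    η-≡∧≡0⇒≡0 ηx≡ηy refl = η-≡nothing⇒≡0 (trans (sym ηx≡ηy) η-0)

    η-*-cong : ∀ {x x′ y y′} → η x ≡ η x′ → η y ≡ η y′ → η (x * y) ≡ η (x′ * y′)
    η-*-cong {x} {x′} {y} {y′} ηx≡ηx′ ηy≡ηy′ with x ≟ 0# | y ≟ 0#
    ... | yes x≡0 | _ = cong η (trans (cong (_* y) x≡0) (trans (zeroˡ y)
                          (sym (trans (cong (_* y′) (η-≡∧≡0⇒≡0 ηx≡ηx′ x≡0)) (zeroˡ y′)))))
    ... | no _ | yes y≡0 = cong η (trans (cong (x *_) y≡0) (trans (zeroʳ x)
                          (sym (trans (cong (x′ *_) (η-≡∧≡0⇒≡0 ηy≡ηy′ y≡0)) (zeroʳ x′)))))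
    ... | no x≢0 | no y≢0
      with a , refl ← log x x≢0 | a′ , refl ← log x′ (x≢0 ∘ η-≡∧≡0⇒≡0 (sym ηx≡ηx′))
         | b , refl ← log y y≢0 | b′ , refl ← log y′ (y≢0 ∘ η-≡∧≡0⇒≡0 (sym ηy≡ηy′)) = begin
      η (g ^ a * g ^ b)    ≡⟨ cong η (sym (^-+ g a b)) ⟩
      η (g ^ (a + b))      ≡⟨ %-≡⇒η-^-≡ (a + b) (a′ + b′) a+b≡a′+b′ ⟩
      η (g ^ (a′ + b′))    ≡⟨ cong η (^-+ g a′ b′) ⟩
      η (g ^ a′ * g ^ b′)  ∎
      where
        a+b≡a′+b′ : (a + b) % k ≡ (a′ + b′) % k
        a+b≡a′+b′ = trans (%-distribˡ-+ a b k) (trans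
          (cong₂ (λ u v → (u + v) % k) (η-^-≡⇒%-≡ a a′ ηx≡ηx′) (η-^-≡⇒%-≡ b b′ ηy≡ηy′))
          (sym (%-distribˡ-+ a′ b′ k)))

    η-*-cancelˡ : ∀ {c c′ x y} → c ≢ 0# → η c ≡ η c′ → η (c * x) ≡ η (c′ * y) → η x ≡ η y
    η-*-cancelˡ {c} {c′} {x} {y} c≢0 ηc≡ηc′ ηcx≡ηc′y with d , cd≡1 ← inverse c c≢0 = begin
      η x              ≡⟨ cong η (sym (inverse-cancelˡ x dc≡1)) ⟩
      η (d * (c * x))  ≡⟨ η-*-cong refl (trans ηcx≡ηc′y (η-*-cong (sym ηc≡ηc′) refl)) ⟩
      η (d * (c * y))  ≡⟨ cong η (inverse-cancelˡ y dc≡1) ⟩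
      η y              ∎
      where
        dc≡1 : d * c ≡ 1#
        dc≡1 = trans (*-comm d c) cd≡1

    cyclotomicMap-0 : ∀ a → cyclotomicMap F k g a 0# ≡ 0#
    cyclotomicMap-0 a rewrite η-0 = refl

    cyclotomicMap-η : ∀ a {x i} → η x ≡ just i → cyclotomicMap F k g a x ≡ a i * x
    cyclotomicMap-η a ηx≡i rewrite ηx≡i = refl

    cyclotomicMap-^ : ∀ a t → cyclotomicMap F k g a (g ^ t) ≡ a (t mod k) * g ^ t
    cyclotomicMap-^ a t = cyclotomicMap-η a (η-^ t)

    cyclotomicMap-sub : ∀ a a′ → (∀ i → a′ i ≡ a i - 1#)
      → ∀ x → cyclotomicMap F k g a x - x ≡ cyclotomicMap F k g a′ x
    cyclotomicMap-sub a a′ a′≡a-1 x with x ≟ 0#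
    ... | yes refl = begin
      cyclotomicMap F k g a 0# - 0#  ≡⟨ cong (_- 0#) (cyclotomicMap-0 a) ⟩
      0# - 0#                        ≡⟨ -‿inverseʳ 0# ⟩
      0#                             ≡⟨ sym (cyclotomicMap-0 a′) ⟩
      cyclotomicMap F k g a′ 0#      ∎
    ... | no x≢0 with t , refl ← log x x≢0 = begin
      cyclotomicMap F k g a (g ^ t) - g ^ t  ≡⟨ cong (_- g ^ t) (cyclotomicMap-^ a t) ⟩
      a (t mod k) * g ^ t - g ^ t            ≡⟨ a*x-x≡[a-1]*x (a (t mod k)) (g ^ t) ⟩
      (a (t mod k) - 1#) * g ^ t             ≡⟨ cong (_* g ^ t) (sym (a′≡a-1 (t mod k))) ⟩
      a′ (t mod k) * g ^ t                   ≡⟨ sym (cyclotomicMap-^ a′ t) ⟩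
      cyclotomicMap F k g a′ (g ^ t)         ∎

    cyclotomicMap-injective⇒≢0 : ∀ a → Injective _≡_ _≡_ (cyclotomicMap F k g a) → ∀ i → a i ≢ 0#
    cyclotomicMap-injective⇒≢0 a θ-inj i aᵢ≡0 = ^-≢0 (toℕ i) g≢0 (θ-inj (begin
      cyclotomicMap F k g a (g ^ toℕ i)  ≡⟨ cyclotomicMap-^ a (toℕ i) ⟩
      a (toℕ i mod k) * g ^ toℕ i        ≡⟨ cong (λ j → a j * g ^ toℕ i) (toℕ-mod i) ⟩
      a i * g ^ toℕ i                    ≡⟨ cong (_* g ^ toℕ i) aᵢ≡0 ⟩
      0# * g ^ toℕ i                     ≡⟨ zeroˡ _ ⟩
      0#                                 ≡⟨ sym (cyclotomicMap-0 a) ⟩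
      cyclotomicMap F k g a 0#           ∎))

    cyclotomicMap-≡0⇒≡0 : ∀ a → (∀ i → a i ≢ 0#) → ∀ {x} → cyclotomicMap F k g a x ≡ 0# → x ≡ 0#
    cyclotomicMap-≡0⇒≡0 a a≢0 {x} θx≡0 with x ≟ 0#
    ... | yes x≡0 = x≡0
    ... | no x≢0 with i , ηx≡i ← η-≢0 x≢0 =
      contradiction (trans (sym (cyclotomicMap-η a ηx≡i)) θx≡0) (*-≢0 (a≢0 i) x≢0)

    cyclotomicMap-injective : ∀ a → (∀ i → a i ≢ 0#) → (∀ i j → η (a i) ≡ η (a j))
      → Injective _≡_ _≡_ (cyclotomicMap F k g a)
    cyclotomicMap-injective a a≢0 ηa≡ηa {x} {y} θx≡θy with x ≟ 0# | y ≟ 0#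
    ... | yes refl | _ = sym (cyclotomicMap-≡0⇒≡0 a a≢0 (trans (sym θx≡θy) (cyclotomicMap-0 a)))
    ... | _ | yes refl = cyclotomicMap-≡0⇒≡0 a a≢0 (trans θx≡θy (cyclotomicMap-0 a))
    ... | no x≢0 | no y≢0 with i , ηx≡i ← η-≢0 x≢0 | j , ηy≡j ← η-≢0 y≢0 =
      *-cancelˡ (a≢0 i) (trans aᵢx≡aⱼy (cong (λ l → a l * y) (sym i≡j)))
      where
        aᵢx≡aⱼy : a i * x ≡ a j * y
        aᵢx≡aⱼy = trans (sym (cyclotomicMap-η a ηx≡i)) (trans θx≡θy (cyclotomicMap-η a ηy≡j))

        i≡j : i ≡ j
        i≡j = just-injective
          (trans (sym ηx≡i) (trans (η-*-cancelˡ (a≢0 i) (ηa≡ηa i j) (cong η aᵢx≡aⱼy)) ηy≡j))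

    nearLinearMap : Carrier → Carrier → Carrier → Carrier
    nearLinearMap b₀ b₁ = cyclotomicMap F k g (nearLinearMultipliers F k b₀ b₁)

    nearLinearMap-sub : ∀ b₀ b₁ x → nearLinearMap b₀ b₁ x - x ≡ nearLinearMap (b₀ - 1#) (b₁ - 1#) x
    nearLinearMap-sub b₀ b₁ = cyclotomicMap-sub _ _ λ { zero → refl ; (suc _) → refl }

    η-≡⇒nearLinearMap-injective : ∀ {b₀ b₁} → b₀ ≢ b₁ → η b₀ ≡ η b₁
      → Injective _≡_ _≡_ (nearLinearMap b₀ b₁)
    η-≡⇒nearLinearMap-injective {b₀} {b₁} b₀≢b₁ ηb₀≡ηb₁ =
      cyclotomicMap-injective _ multiplier≢0 multiplier-η
      where
        multiplier≢0 : ∀ i → nearLinearMultipliers F k b₀ b₁ i ≢ 0#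
        multiplier≢0 zero    b₀≡0 = b₀≢b₁ (trans b₀≡0 (sym (η-≡∧≡0⇒≡0 ηb₀≡ηb₁ b₀≡0)))
        multiplier≢0 (suc _) b₁≡0 = b₀≢b₁ (trans (η-≡∧≡0⇒≡0 (sym ηb₀≡ηb₁) b₁≡0) (sym b₁≡0))

        multiplier-η : ∀ i j
          → η (nearLinearMultipliers F k b₀ b₁ i) ≡ η (nearLinearMultipliers F k b₀ b₁ j)
        multiplier-η zero    zero    = refl
        multiplier-η zero    (suc _) = ηb₀≡ηb₁
        multiplier-η (suc _) zero    = sym ηb₀≡ηb₁
        multiplier-η (suc _) (suc _) = refl

  module NearLinear (k′ : ℕ) (k∣N : suc (suc k′) ∣ N) where
    k : ℕ
    k = suc (suc k′)

    open Classes k k∣N public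

    nearLinearMap-injective⇒η-≡ : ∀ b₀ b₁ → Injective _≡_ _≡_ (nearLinearMap b₀ b₁) → η b₀ ≡ η b₁
    nearLinearMap-injective⇒η-≡ b₀ b₁ θ-inj
      with c , b₁c≡1 ← inverse b₁ (cyclotomicMap-injective⇒≢0 _ θ-inj (suc zero))
      with t , gᵗ≡cb₀ ← log (c * b₀) (*-≢0 (inverse-≢0 b₁c≡1) (cyclotomicMap-injective⇒≢0 _ θ-inj zero))
      with t mod k in t-class
    ... | zero = begin
      η b₀               ≡⟨ cong η (sym (inverse-cancelˡ b₀ b₁c≡1)) ⟩
      η (b₁ * (c * b₀))  ≡⟨ η-*-cong refl ηcb₀≡η1 ⟩
      η (b₁ * 1#)        ≡⟨ cong η (*-identityʳ b₁) ⟩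
      η b₁               ∎
      where
        ηcb₀≡η1 : η (c * b₀) ≡ η 1#
        ηcb₀≡η1 = trans (cong η (sym gᵗ≡cb₀)) (trans (η-^ t) (trans (cong just t-class) (sym (η-^ 0))))
    ... | suc i = contradiction (trans (sym ηgᵗ≡sucᵢ) (trans (cong η gᵗ≡1) (η-^ 0))) λ ()
      where
        ηgᵗ≡sucᵢ : η (g ^ t) ≡ just (suc i)
        ηgᵗ≡sucᵢ = trans (η-^ t) (cong just t-class)

        gᵗ≡1 : g ^ t ≡ g ^ 0
        gᵗ≡1 = θ-inj (begin
          nearLinearMap b₀ b₁ (g ^ t)  ≡⟨ cyclotomicMap-η _ ηgᵗ≡sucᵢ ⟩
          b₁ * g ^ t                   ≡⟨ cong (b₁ *_) gᵗ≡cb₀ ⟩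
          b₁ * (c * b₀)                ≡⟨ inverse-cancelˡ b₀ b₁c≡1 ⟩
          b₀                           ≡⟨ sym (*-identityʳ b₀) ⟩
          b₀ * g ^ 0                   ≡⟨ sym (cyclotomicMap-^ _ 0) ⟩
          nearLinearMap b₀ b₁ (g ^ 0)  ∎)

open FiniteField using (Carrier; q; 1#; _-_)

lemma2p4 : (F : FiniteField) (k : ℕ) .{{_ : NonZero k}} → k ≥ 2 → k ∣ (q F ∸ 1)
    → (g : Carrier F) → Primitive F g → (a₀ a₁ : Carrier F)
    → IsNearLinearOrthomorphism F k g (nearLinearMultipliers F k a₀ a₁)
      ⇔ (a₀ ≢ a₁ × eta F k g a₀ ≡ eta F k g a₁
           × eta F k g (_-_ F a₀ (1# F)) ≡ eta F k g (_-_ F a₁ (1# F)))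
lemma2p4 F (suc (suc k′)) (s≤s (s≤s _)) k∣N g prim a₀ a₁ = mk⇔
  (λ (orthomorphism , multipliers-distinct , _) →
    let a₀≢a₁ = multipliers-distinct zero (suc zero) refl λ ()
        (θ-injective , θ-id-injective) = Equivalence.to (isOrthomorphism⇔ _) orthomorphism
    in a₀≢a₁ , nearLinearMap-injective⇒η-≡ a₀ a₁ θ-injective
             , nearLinearMap-injective⇒η-≡ _ _ (injective-≗ (nearLinearMap-sub a₀ a₁) θ-id-injective))
  (λ (a₀≢a₁ , ηa≡ηa , ηa-1≡ηa-1) →
    Equivalence.from (isOrthomorphism⇔ _)
      ( η-≡⇒nearLinearMap-injective a₀≢a₁ ηa≡ηa
      , injective-≗ (sym ∘ nearLinearMap-sub a₀ a₁)
          (η-≡⇒nearLinearMap-injective (a₀≢a₁ ∘ a-1≡b-1⇒a≡b) ηa-1≡ηa-1))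
    , nearLinearMultipliers-distinct a₀≢a₁ , nearLinearMultipliers-constant)
  where
    open FieldProperties F
    open PrimitiveElement F g prim
    open NearLinear k′ k∣N
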